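{- For every finite simple graph $G$, \[ \alpha(G) \le \mu(G) + |\mathrm{core}(G)| - \mu(G[N_G[\mathrm{core}(G)]]). \]
   Context: $\mathrm{core}(G)$ is the intersection of all maximum independent sets of $G$. $\alpha(G)$ is the independence number and $\mu(H)$ the matching number of a graph $H$ ($0$ if $H$ has no edges). For $S \subseteq V(G)$, $N_G[S] = S \cup \bigcup_{v \in S} N_G(v)$ and $G[S]$ is the induced subgraph on $S$. -}

module Defs where

open import Data.Nat using (ℕ; _≤_)
open import Data.Fin using (Fin)
open import Data.Fin.Subset using (Subset; _∈_; ∣_∣)
open import Data.List using (List; []; _∷_; _++_; length)
open import Data.List.Relation.Unary.All using (All)
open import Data.List.Relation.Unary.Unique.Propositional using (Unique)
open import Data.Product using (Σ; ∃; _×_; _,_)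
open import Data.Sum using (_⊎_)
open import Data.Empty using (⊥)
open import Data.Unit using (⊤)
open import Relation.Nullary using (¬_)
open import Relation.Binary.PropositionalEquality using (_≡_)
open import Function.Bundles using (_⇔_)

record Graph (n : ℕ) : Set₁ where
  field
    Adj     : Fin n → Fin n → Set
    sym     : ∀ {u v} → Adj u v → Adj v u
    irrefl  : ∀ {v} → ¬ Adj v v
open Graph public

IsMaximum : {A : Set} → (A → Set) → (A → ℕ) → ℕ → Set
IsMaximum {A} P size k = (Σ A λ x → P x × size x ≡ k) × (∀ x → P x → size x ≤ k)

module _ {n : ℕ} (G : Graph n) where

  Independent : Subset n → Set
  Independent S = ∀ u v → u ∈ S → v ∈ S → ¬ Adj G u v

  IsIndependenceNumber : ℕ → Set
  IsIndependenceNumber = IsMaximum Independent ∣_∣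

  MaximumIndependent : Subset n → Set
  MaximumIndependent S = Independent S × (∀ T → Independent T → ∣ T ∣ ≤ ∣ S ∣)

  IsCore : Subset n → Set
  IsCore C = ∀ v → (v ∈ C) ⇔ (∀ S → MaximumIndependent S → v ∈ S)

  InClosedNbhd : Subset n → Fin n → Set
  InClosedNbhd C v = v ∈ C ⊎ (Σ (Fin n) λ u → u ∈ C × Adj G u v)

  endpoints : List (Fin n × Fin n) → List (Fin n)
  endpoints [] = []
  endpoints ((u , v) ∷ es) = u ∷ v ∷ endpoints es

  IsMatchingIn : (Fin n → Set) → List (Fin n × Fin n) → Set
  IsMatchingIn W M =
    All (λ { (u , v) → Adj G u v × W u × W v }) M × Unique (endpoints M)

  IsMatchingNumberIn : (Fin n → Set) → ℕ → Set
  IsMatchingNumberIn W = IsMaximum (IsMatchingIn W) length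

  IsMatchingNumber : ℕ → Set
  IsMatchingNumber = IsMatchingNumberIn (λ _ → ⊤)

-- Fix a maximum independent set S; the core C lies in S, and S ∖ C avoids the closed
-- neighbourhood N[C].  No subset A of S ∖ C is deficient, i.e. has fewer than |A|
-- neighbours in Y = V ∖ (S ∪ N[C]): a vertex v ∈ A lies outside C, so some maximum
-- independent set T misses v, and exchanging T ∩ N(A ∖ T) for A ∖ T shows that the
-- strictly smaller set A ∩ T would be deficient too.  By Hall's theorem S ∖ C is then
-- matched into Y, and these edges are disjoint from any matching of G[N[C]]; hence
-- |S| − |C| + μ(G[N[C]]) ≤ μ(G).  Adjacency need not be decidable, but the conclusion is
-- a decidable (hence ¬¬-stable) inequality, so we may assume it for the finitely many pairs.
module Submission where

open import Data.Nat using (ℕ; zero; suc; _+_; _∸_; _≤_; _<_; z≤n; _≤?_; _<?_)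
open import Data.Nat.Properties hiding (_≟_)
open import Data.Bool using (true; false)
open import Data.Fin using (Fin; zero; suc)
open import Data.Fin.Properties using (any?; _≟_)
open import Data.Fin.Subset hiding (⊤)
open import Data.Fin.Subset.Properties
open import Data.Vec using ([]; _∷_; here; there)
open import Data.List using (List; []; _∷_; _++_; length)
open import Data.List.Properties using (length-++)
open import Data.List.Relation.Unary.All as All using (All; []; _∷_)
import Data.List.Relation.Unary.All.Properties as All
open import Data.List.Relation.Unary.Unique.Propositional using (Unique; []; _∷_)
import Data.List.Relation.Unary.Unique.Propositional.Properties as Unique
open import Data.Product using (∃; _×_; _,_; proj₁; proj₂)
open import Data.Sum using (_⊎_; inj₁; inj₂; [_,_]′)
open import Data.Unit using (⊤; tt)
open import Function using (_∘_)
open import Function.Bundles using (Equivalence)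
open import Relation.Unary using (Decidable)
open import Relation.Nullary using (Dec; ¬_; yes; no; does; contradiction)
open import Relation.Nullary.Decidable using (_×-dec_; _⊎-dec_; ¬?; decidable-stable; ¬¬-excluded-middle)
open import Relation.Nullary.Negation using (¬¬-map)
open import Relation.Binary.PropositionalEquality as ≡ using (_≡_; _≢_; refl; cong; cong₂; subst; module ≡-Reasoning)

open import Defs hiding (sym)

-- Finite subsets

private variable
  n : ℕ
  x : Fin n

filter : {P : Fin n → Set} → Decidable P → Subset n
filter {zero}  P? = []
filter {suc n} P? = does (P? zero) ∷ filter (P? ∘ suc)

∈-filter⁺ : {P : Fin n → Set} (P? : Decidable P) → P x → x ∈ filter P?
∈-filter⁺ {x = zero} P? px with P? zero
... | yes _  = here
... | no ¬px = contradiction px ¬px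
∈-filter⁺ {x = suc x} P? px = there (∈-filter⁺ (P? ∘ suc) px)

∈-filter⁻ : {P : Fin n → Set} (P? : Decidable P) → x ∈ filter P? → P x
∈-filter⁻ {x = zero} P? x∈ with P? zero
∈-filter⁻ {x = zero} P? x∈   | yes px = px
∈-filter⁻ {x = zero} P? ()   | no _
∈-filter⁻ {x = suc x} P? (there x∈) = ∈-filter⁻ (P? ∘ suc) x∈

x∈p─q⇒x∉q : (p q : Subset n) → x ∈ p ─ q → x ∉ q
x∈p─q⇒x∉q (true ∷ p) (false ∷ q) here = λ ()
x∈p─q⇒x∉q (_ ∷ p) (_ ∷ q) (there x∈) (there x∈q) = x∈p─q⇒x∉q p q x∈ x∈q

∣p∪q∣+∣p∩q∣≡∣p∣+∣q∣ : (p q : Subset n) → ∣ p ∪ q ∣ + ∣ p ∩ q ∣ ≡ ∣ p ∣ + ∣ q ∣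
∣p∪q∣+∣p∩q∣≡∣p∣+∣q∣ [] [] = refl
∣p∪q∣+∣p∩q∣≡∣p∣+∣q∣ (false ∷ p) (false ∷ q) = ∣p∪q∣+∣p∩q∣≡∣p∣+∣q∣ p q
∣p∪q∣+∣p∩q∣≡∣p∣+∣q∣ (true  ∷ p) (false ∷ q) = cong suc (∣p∪q∣+∣p∩q∣≡∣p∣+∣q∣ p q)
∣p∪q∣+∣p∩q∣≡∣p∣+∣q∣ (false ∷ p) (true  ∷ q) =
  ≡.trans (cong suc (∣p∪q∣+∣p∩q∣≡∣p∣+∣q∣ p q)) (≡.sym (+-suc ∣ p ∣ ∣ q ∣))
∣p∪q∣+∣p∩q∣≡∣p∣+∣q∣ (true  ∷ p) (true  ∷ q) =
  cong suc (≡.trans (+-suc ∣ p ∪ q ∣ ∣ p ∩ q ∣)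
                  (≡.trans (cong suc (∣p∪q∣+∣p∩q∣≡∣p∣+∣q∣ p q)) (≡.sym (+-suc ∣ p ∣ ∣ q ∣))))

Disjoint : Subset n → Subset n → Set
Disjoint p q = ∀ {x} → x ∈ p → x ∉ q

p⊆q∪r⇒∣p∣≤∣q∣+∣r∣ : {p q r : Subset n} → p ⊆ q ∪ r → ∣ p ∣ ≤ ∣ q ∣ + ∣ r ∣
p⊆q∪r⇒∣p∣≤∣q∣+∣r∣ {p = p} {q} {r} p⊆q∪r = begin
  ∣ p ∣                     ≤⟨ p⊆q⇒∣p∣≤∣q∣ p⊆q∪r ⟩
  ∣ q ∪ r ∣                 ≤⟨ m≤m+n ∣ q ∪ r ∣ ∣ q ∩ r ∣ ⟩
  ∣ q ∪ r ∣ + ∣ q ∩ r ∣     ≡⟨ ∣p∪q∣+∣p∩q∣≡∣p∣+∣q∣ q r ⟩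
  ∣ q ∣ + ∣ r ∣             ∎
  where open ≤-Reasoning

disjoint⇒∣p∣+∣q∣≡∣p∪q∣ : {p q : Subset n} → Disjoint p q → ∣ p ∣ + ∣ q ∣ ≡ ∣ p ∪ q ∣
disjoint⇒∣p∣+∣q∣≡∣p∪q∣ {n} {p} {q} p⊥q = begin
  ∣ p ∣ + ∣ q ∣             ≡⟨ ∣p∪q∣+∣p∩q∣≡∣p∣+∣q∣ p q ⟨
  ∣ p ∪ q ∣ + ∣ p ∩ q ∣     ≡⟨ cong (λ s → ∣ p ∪ q ∣ + ∣ s ∣) p∩q≡⊥ ⟩
  ∣ p ∪ q ∣ + ∣ ⊥ {n} ∣     ≡⟨ cong (∣ p ∪ q ∣ +_) (∣⊥∣≡0 n) ⟩
  ∣ p ∪ q ∣ + 0             ≡⟨ +-identityʳ ∣ p ∪ q ∣ ⟩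
  ∣ p ∪ q ∣                 ∎
  where
  open ≡-Reasoning
  p∩q≡⊥ : p ∩ q ≡ ⊥
  p∩q≡⊥ = Empty-unique λ (x , x∈p∩q) → let x∈p , x∈q = x∈p∩q⁻ p q x∈p∩q in p⊥q x∈p x∈q

disjoint⇒∣p∣+∣q∣≤∣r∣ : {p q r : Subset n} → Disjoint p q → p ⊆ r → q ⊆ r → ∣ p ∣ + ∣ q ∣ ≤ ∣ r ∣
disjoint⇒∣p∣+∣q∣≤∣r∣ {p = p} {q} p⊥q p⊆r q⊆r =
  subst (_≤ _) (≡.sym (disjoint⇒∣p∣+∣q∣≡∣p∪q∣ p⊥q))
        (p⊆q⇒∣p∣≤∣q∣ λ x∈p∪q → [ p⊆r , q⊆r ]′ (x∈p∪q⁻ p q x∈p∪q))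

∣p∣≤∣p∩q∣+∣p─q∣ : (p q : Subset n) → ∣ p ∣ ≤ ∣ p ∩ q ∣ + ∣ p ─ q ∣
∣p∣≤∣p∩q∣+∣p─q∣ p q = p⊆q∪r⇒∣p∣≤∣q∣+∣r∣ (x∈p∪q⁺ ∘ split)
  where
  split : ∀ {x} → x ∈ p → x ∈ p ∩ q ⊎ x ∈ p ─ q
  split {x} x∈p with x ∈? q
  ... | yes x∈q = inj₁ (x∈p∩q⁺ (x∈p , x∈q))
  ... | no  x∉q = inj₂ (x∈p∧x∉q⇒x∈p─q x∈p x∉q)

x∈p⇒0<∣p∣ : {p : Subset n} → x ∈ p → 0 < ∣ p ∣
x∈p⇒0<∣p∣ x∈p = ≤-<-trans z≤n (x∈p⇒∣p-x∣<∣p∣ x∈p)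

empty⇒∣p∣≡0 : {p : Subset n} → Empty p → ∣ p ∣ ≡ 0
empty⇒∣p∣≡0 {n} ∅p = ≡.trans (cong ∣_∣ (Empty-unique ∅p)) (∣⊥∣≡0 n)

0<∣p∣⇒nonempty : (p : Subset n) → 0 < ∣ p ∣ → Nonempty p
0<∣p∣⇒nonempty p 0<∣p∣ with nonempty? p
... | yes ne = ne
... | no  ∅p = contradiction (subst (0 <_) (empty⇒∣p∣≡0 ∅p) 0<∣p∣) (n≮n 0)

x∈p⇒⁅x⁆⊆p : {p : Subset n} → x ∈ p → ⁅ x ⁆ ⊆ p
x∈p⇒⁅x⁆⊆p {x = x} {p} x∈p y∈⁅x⁆ = subst (_∈ p) (≡.sym (x∈⁅y⁆⇒x≡y x y∈⁅x⁆)) x∈p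

disjoint-⊆ : {p q p′ q′ : Subset n} → p ⊆ p′ → q ⊆ q′ → Disjoint p′ q′ → Disjoint p q
disjoint-⊆ p⊆p′ q⊆q′ p′⊥q′ x∈p x∈q = p′⊥q′ (p⊆p′ x∈p) (q⊆q′ x∈q)

q⊆p⇒∣q∣+∣p─q∣≡∣p∣ : {p q : Subset n} → q ⊆ p → ∣ q ∣ + ∣ p ─ q ∣ ≡ ∣ p ∣
q⊆p⇒∣q∣+∣p─q∣≡∣p∣ {p = p} {q} q⊆p = ≤-antisym
  (disjoint⇒∣p∣+∣q∣≤∣r∣ (λ x∈q x∈p─q → x∈p─q⇒x∉q p q x∈p─q x∈q) q⊆p (p─q⊆p p q))
  (≤-trans (∣p∣≤∣p∩q∣+∣p─q∣ p q) (+-monoˡ-≤ ∣ p ─ q ∣ (p⊆q⇒∣p∣≤∣q∣ (p∩q⊆q p q))))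

module _ {n : ℕ} (G : Graph n) where

  endpoints-++ : (es fs : List (Fin n × Fin n)) → endpoints G (es ++ fs) ≡ endpoints G es ++ endpoints G fs
  endpoints-++ []             fs = refl
  endpoints-++ ((u , v) ∷ es) fs = cong (λ ws → u ∷ v ∷ ws) (endpoints-++ es fs)

  BothEnds : (Fin n → Set) → Fin n × Fin n → Set
  BothEnds P (u , v) = P u × P v

  All-endpoints : {P : Fin n → Set} {es : List (Fin n × Fin n)} → All (BothEnds P) es → All P (endpoints G es)
  All-endpoints []              = []
  All-endpoints ((pu , pv) ∷ ps) = pu ∷ pv ∷ All-endpoints ps

  unique-endpoints-++ : {P Q : Fin n → Set} {es fs : List (Fin n × Fin n)} → (∀ {v} → P v → ¬ Q v) →
                        All (BothEnds P) es → All (BothEnds Q) fs →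
                        Unique (endpoints G es) → Unique (endpoints G fs) → Unique (endpoints G (es ++ fs))
  unique-endpoints-++ {es = es} {fs} P⊥Q Pes Qfs es! fs! rewrite endpoints-++ es fs =
    Unique.++⁺ es! fs! λ (v∈es , v∈fs) →
      P⊥Q (All.lookup (All-endpoints Pes) v∈es) (All.lookup (All-endpoints Qfs) v∈fs)

module _ {n : ℕ} (G : Graph n) (adj? : ∀ u v → Dec (Adj G u v)) where

  N : Subset n → Subset n
  N A = filter λ v → any? λ u → u ∈? A ×-dec adj? u v

  ∈N⁺ : {A : Subset n} {u v : Fin n} → u ∈ A → Adj G u v → v ∈ N A
  ∈N⁺ u∈A uv = ∈-filter⁺ _ (_ , u∈A , uv)

  ∈N⁻ : {A : Subset n} {v : Fin n} → v ∈ N A → ∃ λ u → u ∈ A × Adj G u v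
  ∈N⁻ = ∈-filter⁻ _

  N-mono : {A B : Subset n} → A ⊆ B → N A ⊆ N B
  N-mono A⊆B v∈NA = let u , u∈A , uv = ∈N⁻ v∈NA in ∈N⁺ (A⊆B u∈A) uv

  Between : Subset n → Subset n → Fin n × Fin n → Set
  Between X Y (x , y) = x ∈ X × y ∈ Y × Adj G x y

  record MatchingInto (X Y : Subset n) : Set where
    field
      edges     : List (Fin n × Fin n)
      between   : All (Between X Y) edges
      unique    : Unique (endpoints G edges)
      saturates : length edges ≡ ∣ X ∣

    ends : All (BothEnds G λ v → v ∈ X ⊎ v ∈ Y) edges
    ends = All.map (λ (x∈X , y∈Y , _) → inj₁ x∈X , inj₂ y∈Y) between

  open MatchingInto

  ∅-matching : {X Y : Subset n} → Empty X → MatchingInto X Y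
  ∅-matching {X} ∅X = record
    { edges = [] ; between = [] ; unique = []
    ; saturates = ≡.sym (empty⇒∣p∣≡0 ∅X) }

  edge-matching : {x y : Fin n} → x ≢ y → Adj G x y → MatchingInto ⁅ x ⁆ ⁅ y ⁆
  edge-matching {x} {y} x≢y xy = record
    { edges = (x , y) ∷ []
    ; between = (x∈⁅x⁆ x , x∈⁅x⁆ y , xy) ∷ []
    ; unique = (x≢y ∷ []) ∷ [] ∷ []
    ; saturates = ≡.sym (∣⁅x⁆∣≡1 x) }

  extend : {X Y A B : Subset n} → Disjoint X Y → A ⊆ X → B ⊆ Y →
           MatchingInto A B → MatchingInto (X ─ A) (Y ─ B) → MatchingInto X Y
  extend {X} {Y} {A} {B} X⊥Y A⊆X B⊆Y M₁ M₂ = record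
    { edges = edges M₁ ++ edges M₂
    ; between = All.++⁺ (All.map (widen A⊆X B⊆Y) (between M₁))
                        (All.map (widen (p─q⊆p X A) (p─q⊆p Y B)) (between M₂))
    ; unique = unique-endpoints-++ G separated (ends M₁) (ends M₂) (unique M₁) (unique M₂)
    ; saturates = begin
        length (edges M₁ ++ edges M₂)        ≡⟨ length-++ (edges M₁) ⟩
        length (edges M₁) + length (edges M₂) ≡⟨ cong₂ _+_ (saturates M₁) (saturates M₂) ⟩
        ∣ A ∣ + ∣ X ─ A ∣                    ≡⟨ q⊆p⇒∣q∣+∣p─q∣≡∣p∣ A⊆X ⟩
        ∣ X ∣                                ∎ }
    where
    open ≡-Reasoning
    widen : {X′ Y′ : Subset n} → X′ ⊆ X → Y′ ⊆ Y → {e : Fin n × Fin n} → Between X′ Y′ e → Between X Y e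
    widen X′⊆X Y′⊆Y (x∈X′ , y∈Y′ , xy) = X′⊆X x∈X′ , Y′⊆Y y∈Y′ , xy
    separated : {v : Fin n} → v ∈ A ⊎ v ∈ B → ¬ (v ∈ X ─ A ⊎ v ∈ Y ─ B)
    separated (inj₁ v∈A) (inj₁ v∈X─A) = x∈p─q⇒x∉q X A v∈X─A v∈A
    separated (inj₁ v∈A) (inj₂ v∈Y─B) = X⊥Y (A⊆X v∈A) (p─q⊆p Y B v∈Y─B)
    separated (inj₂ v∈B) (inj₁ v∈X─A) = X⊥Y (p─q⊆p X A v∈X─A) (B⊆Y v∈B)
    separated (inj₂ v∈B) (inj₂ v∈Y─B) = x∈p─q⇒x∉q Y B v∈Y─B v∈B

  -- Hall's theorem

  HallCondition : Subset n → Subset n → Set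
  HallCondition X Y = ∀ A → A ⊆ X → ∣ A ∣ ≤ ∣ Y ∩ N A ∣

  Critical : Subset n → Subset n → Subset n → Set
  Critical X Y A = A ⊆ X × Nonempty A × ∣ A ∣ < ∣ X ∣ × ∣ Y ∩ N A ∣ ≤ ∣ A ∣

  critical? : (X Y : Subset n) → Decidable (Critical X Y)
  critical? X Y A = A ⊆? X ×-dec nonempty? A ×-dec ∣ A ∣ <? ∣ X ∣ ×-dec ∣ Y ∩ N A ∣ ≤? ∣ A ∣

  hall-critical-inside : {X Y A : Subset n} → HallCondition X Y → A ⊆ X → HallCondition A (Y ∩ N A)
  hall-critical-inside {X} {Y} {A} hallXY A⊆X B B⊆A =
    ≤-trans (hallXY B (⊆-trans B⊆A A⊆X)) (p⊆q⇒∣p∣≤∣q∣ λ v∈Y∩NB →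
      let v∈Y , v∈NB = x∈p∩q⁻ Y (N B) v∈Y∩NB
      in x∈p∩q⁺ (x∈p∩q⁺ (v∈Y , N-mono B⊆A v∈NB) , v∈NB))

  hall-critical-outside : {X Y A : Subset n} → HallCondition X Y → A ⊆ X → ∣ Y ∩ N A ∣ ≤ ∣ A ∣ →
                          HallCondition (X ─ A) (Y ─ (Y ∩ N A))
  hall-critical-outside {X} {Y} {A} hallXY A⊆X tight B B⊆X─A = +-cancelˡ-≤ ∣ A ∣ ∣ B ∣ _ (begin
    ∣ A ∣ + ∣ B ∣                         ≡⟨ disjoint⇒∣p∣+∣q∣≡∣p∪q∣ A⊥B ⟩
    ∣ A ∪ B ∣                             ≤⟨ hallXY (A ∪ B) A∪B⊆X ⟩
    ∣ Y ∩ N (A ∪ B) ∣                     ≤⟨ p⊆q∪r⇒∣p∣≤∣q∣+∣r∣ (x∈p∪q⁺ ∘ split) ⟩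
    ∣ Y ∩ N A ∣ + ∣ Y′ ∩ N B ∣            ≤⟨ +-monoˡ-≤ ∣ Y′ ∩ N B ∣ tight ⟩
    ∣ A ∣ + ∣ Y′ ∩ N B ∣                  ∎)
    where
    open ≤-Reasoning
    Y′ = Y ─ (Y ∩ N A)
    A⊥B : Disjoint A B
    A⊥B v∈A v∈B = x∈p─q⇒x∉q X A (B⊆X─A v∈B) v∈A
    A∪B⊆X : A ∪ B ⊆ X
    A∪B⊆X v∈A∪B = [ A⊆X , p─q⊆p X A ∘ B⊆X─A ]′ (x∈p∪q⁻ A B v∈A∪B)
    split : ∀ {v} → v ∈ Y ∩ N (A ∪ B) → v ∈ Y ∩ N A ⊎ v ∈ Y′ ∩ N B
    split {v} v∈ with x∈p∩q⁻ Y (N (A ∪ B)) v∈ | v ∈? Y ∩ N A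
    ... | _ | yes v∈Y∩NA = inj₁ v∈Y∩NA
    ... | v∈Y , v∈N[A∪B] | no v∉Y∩NA with ∈N⁻ v∈N[A∪B]
    ...   | u , u∈A∪B , uv with x∈p∪q⁻ A B u∈A∪B
    ...     | inj₁ u∈A = contradiction (x∈p∩q⁺ (v∈Y , ∈N⁺ u∈A uv)) v∉Y∩NA
    ...     | inj₂ u∈B = inj₂ (x∈p∩q⁺ (x∈p∧x∉q⇒x∈p─q v∈Y v∉Y∩NA , ∈N⁺ u∈B uv))

  hall-noncritical : {X Y : Subset n} {x : Fin n} (y : Fin n) → (∀ B → ¬ Critical X Y B) → x ∈ X →
                     HallCondition (X - x) (Y - y)
  hall-noncritical {X} {Y} {x} y noCritical x∈X B B⊆X-x with nonempty? B
  ... | no ∅B = subst (_≤ ∣ (Y - y) ∩ N B ∣) (≡.sym (empty⇒∣p∣≡0 ∅B)) z≤n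
  ... | yes neB = ≤-pred (begin-strict
    ∣ B ∣                          <⟨ ≰⇒> (λ tight → noCritical B (B⊆X , neB , ∣B∣<∣X∣ , tight)) ⟩
    ∣ Y ∩ N B ∣                    ≤⟨ p⊆q∪r⇒∣p∣≤∣q∣+∣r∣ (x∈p∪q⁺ ∘ split) ⟩
    ∣ (Y - y) ∩ N B ∣ + ∣ ⁅ y ⁆ ∣   ≡⟨ cong (∣ (Y - y) ∩ N B ∣ +_) (∣⁅x⁆∣≡1 y) ⟩
    ∣ (Y - y) ∩ N B ∣ + 1          ≡⟨ +-comm _ 1 ⟩
    suc ∣ (Y - y) ∩ N B ∣          ∎)
    where
    open ≤-Reasoning
    B⊆X : B ⊆ X
    B⊆X = p─q⊆p X ⁅ x ⁆ ∘ B⊆X-x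
    ∣B∣<∣X∣ : ∣ B ∣ < ∣ X ∣
    ∣B∣<∣X∣ = p⊂q⇒∣p∣<∣q∣ (B⊆X , x , x∈X , λ x∈B → x∈p─q⇒x∉q X ⁅ x ⁆ (B⊆X-x x∈B) (x∈⁅x⁆ x))
    split : ∀ {v} → v ∈ Y ∩ N B → v ∈ (Y - y) ∩ N B ⊎ v ∈ ⁅ y ⁆
    split {v} v∈Y∩NB with v ≟ y
    ... | yes refl = inj₂ (x∈⁅x⁆ y)
    ... | no  v≢y  = let v∈Y , v∈NB = x∈p∩q⁻ Y (N B) v∈Y∩NB
                     in inj₁ (x∈p∩q⁺ (x∈p∧x≢y⇒x∈p-y v∈Y v≢y , v∈NB))

  hall-neighbour : {X Y : Subset n} {x : Fin n} → HallCondition X Y → x ∈ X → ∃ λ y → y ∈ Y × Adj G x y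
  hall-neighbour {X} {Y} {x} hallXY x∈X =
    let y , y∈Y∩N⁅x⁆ = 0<∣p∣⇒nonempty (Y ∩ N ⁅ x ⁆)
                         (subst (_≤ ∣ Y ∩ N ⁅ x ⁆ ∣) (∣⁅x⁆∣≡1 x) (hallXY ⁅ x ⁆ (x∈p⇒⁅x⁆⊆p x∈X)))
        y∈Y , y∈N⁅x⁆ = x∈p∩q⁻ Y (N ⁅ x ⁆) y∈Y∩N⁅x⁆
        u , u∈⁅x⁆ , uy = ∈N⁻ y∈N⁅x⁆
    in y , y∈Y , subst (λ w → Adj G w y) (x∈⁅y⁆⇒x≡y x u∈⁅x⁆) uy

  -- Induction on |X|: split X along a critical set if there is one; otherwise match any
  -- x ∈ X to any neighbour y, the strict surplus of every proper subset paying for y.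
  hall : {X Y : Subset n} (k : ℕ) → ∣ X ∣ ≤ k → Disjoint X Y → HallCondition X Y → MatchingInto X Y
  hall zero ∣X∣≤0 _ _ = ∅-matching λ (x , x∈X) → contradiction (≤-trans (x∈p⇒0<∣p∣ x∈X) ∣X∣≤0) λ ()
  hall {X} {Y} (suc k) ∣X∣≤1+k X⊥Y hallXY with anySubset? (critical? X Y)
  ... | yes (A , A⊆X , (a , a∈A) , ∣A∣<∣X∣ , tight) =
    extend X⊥Y A⊆X (p∩q⊆p Y (N A))
      (hall k (smaller A ∣A∣<∣X∣) (disjoint-⊆ A⊆X (p∩q⊆p Y (N A)) X⊥Y)
              (hall-critical-inside {Y = Y} hallXY A⊆X))
      (hall k (smaller (X ─ A) (p∩q≢∅⇒∣p─q∣<∣p∣ X A (a , x∈p∩q⁺ (A⊆X a∈A , a∈A))))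
              (disjoint-⊆ (p─q⊆p X A) (p─q⊆p Y _) X⊥Y)
              (hall-critical-outside {Y = Y} hallXY A⊆X tight))
    where
    smaller : (p : Subset n) → ∣ p ∣ < ∣ X ∣ → ∣ p ∣ ≤ k
    smaller _ ∣p∣<∣X∣ = ≤-pred (<-≤-trans ∣p∣<∣X∣ ∣X∣≤1+k)
  ... | no noCritical with nonempty? X
  ...   | no ∅X = ∅-matching ∅X
  ...   | yes (x , x∈X) =
    let y , y∈Y , xy = hall-neighbour hallXY x∈X
    in extend X⊥Y (x∈p⇒⁅x⁆⊆p x∈X) (x∈p⇒⁅x⁆⊆p y∈Y)
         (edge-matching (λ x≡y → X⊥Y x∈X (subst (_∈ Y) (≡.sym x≡y) y∈Y)) xy)
         (hall k (≤-pred (<-≤-trans (x∈p⇒∣p-x∣<∣p∣ x∈X) ∣X∣≤1+k))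
                 (disjoint-⊆ (p─q⊆p X ⁅ x ⁆) (p─q⊆p Y ⁅ y ⁆) X⊥Y)
                 (hall-noncritical {Y = Y} y (λ B → noCritical ∘ (B ,_)) x∈X))

  matching-++ : {X Y : Subset n} {W : Fin n → Set} {es : List (Fin n × Fin n)} (L : MatchingInto X Y) →
                (∀ {v} → v ∈ X ⊎ v ∈ Y → ¬ W v) → IsMatchingIn G W es →
                IsMatchingIn G (λ _ → ⊤) (edges L ++ es)
  matching-++ L avoidsW (es-in-W , es!) =
      All.++⁺ (All.map (λ (_ , _ , xy) → xy , tt , tt) (between L))
              (All.map (λ (uv , _) → uv , tt , tt) es-in-W)
    , unique-endpoints-++ G avoidsW (ends L) (All.map (λ (_ , Wu , Wv) → Wu , Wv) es-in-W) (unique L) es!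

  -- Maximum independent sets and the core

  -- (T ∖ N(B)) ∪ B is independent, so by maximality B is no larger than what it displaces.
  exchange-bound : {T B : Subset n} → MaximumIndependent G T → Independent G B → Disjoint B T → ∣ B ∣ ≤ ∣ T ∩ N B ∣
  exchange-bound {T} {B} (T-ind , T-max) B-ind B⊥T = +-cancelˡ-≤ ∣ T ─ N B ∣ ∣ B ∣ _ (begin
    ∣ T ─ N B ∣ + ∣ B ∣           ≡⟨ disjoint⇒∣p∣+∣q∣≡∣p∪q∣ (λ v∈T─NB v∈B → B⊥T v∈B (p─q⊆p T (N B) v∈T─NB)) ⟩
    ∣ (T ─ N B) ∪ B ∣             ≤⟨ T-max ((T ─ N B) ∪ B) swapped-independent ⟩
    ∣ T ∣                         ≤⟨ ∣p∣≤∣p∩q∣+∣p─q∣ T (N B) ⟩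
    ∣ T ∩ N B ∣ + ∣ T ─ N B ∣     ≡⟨ +-comm ∣ T ∩ N B ∣ ∣ T ─ N B ∣ ⟩
    ∣ T ─ N B ∣ + ∣ T ∩ N B ∣     ∎)
    where
    open ≤-Reasoning
    swapped-independent : Independent G ((T ─ N B) ∪ B)
    swapped-independent u v u∈ v∈ uv with x∈p∪q⁻ (T ─ N B) B u∈ | x∈p∪q⁻ (T ─ N B) B v∈
    ... | inj₁ u∈T─NB | inj₁ v∈T─NB = T-ind u v (p─q⊆p T (N B) u∈T─NB) (p─q⊆p T (N B) v∈T─NB) uv
    ... | inj₁ u∈T─NB | inj₂ v∈B    = x∈p─q⇒x∉q T (N B) u∈T─NB (∈N⁺ v∈B (Graph.sym G uv))
    ... | inj₂ u∈B    | inj₁ v∈T─NB = x∈p─q⇒x∉q T (N B) v∈T─NB (∈N⁺ u∈B uv)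
    ... | inj₂ u∈B    | inj₂ v∈B    = B-ind u v u∈B v∈B uv

  module CoreMatching {S C : Subset n} (S-max : MaximumIndependent G S) (C-core : IsCore G C) where

    C⊆maximum : {T : Subset n} → MaximumIndependent G T → C ⊆ T
    C⊆maximum {T} T-max {c} c∈C = Equivalence.to (C-core c) c∈C T T-max

    S-ind : Independent G S
    S-ind = proj₁ S-max

    S─C-avoids-N[C] : {v : Fin n} → v ∈ S ─ C → ¬ InClosedNbhd G C v
    S─C-avoids-N[C] v∈S─C (inj₁ v∈C)           = x∈p─q⇒x∉q S C v∈S─C v∈C
    S─C-avoids-N[C] v∈S─C (inj₂ (c , c∈C , cv)) = S-ind _ _ (C⊆maximum S-max c∈C) (p─q⊆p S C v∈S─C) cv

    Y : Subset n
    Y = filter λ v → ¬? (v ∈? S ⊎-dec (v ∈? C ⊎-dec any? λ c → c ∈? C ×-dec adj? c v))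

    Y-avoids : {v : Fin n} → v ∈ Y → ¬ (v ∈ S ⊎ InClosedNbhd G C v)
    Y-avoids = ∈-filter⁻ _

    deficiency-shrinks : {A T : Subset n} → MaximumIndependent G T → A ⊆ S → ∣ Y ∩ N A ∣ < ∣ A ∣ →
                         ∣ Y ∩ N (A ∩ T) ∣ < ∣ A ∩ T ∣
    deficiency-shrinks {A} {T} T-max@(T-ind , _) A⊆S deficient = +-cancelʳ-< ∣ A ─ T ∣ _ _ (begin-strict
      ∣ Y ∩ N (A ∩ T) ∣ + ∣ A ─ T ∣           ≤⟨ +-monoʳ-≤ ∣ Y ∩ N (A ∩ T) ∣ A─T-exchange ⟩
      ∣ Y ∩ N (A ∩ T) ∣ + ∣ T ∩ N (A ─ T) ∣   ≤⟨ disjoint⇒∣p∣+∣q∣≤∣r∣ T-separates inner⊆ outer⊆ ⟩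
      ∣ Y ∩ N A ∣                             <⟨ deficient ⟩
      ∣ A ∣                                   ≤⟨ ∣p∣≤∣p∩q∣+∣p─q∣ A T ⟩
      ∣ A ∩ T ∣ + ∣ A ─ T ∣                   ∎)
      where
      open ≤-Reasoning
      A─T⊆S : A ─ T ⊆ S
      A─T⊆S = A⊆S ∘ p─q⊆p A T
      A─T-exchange : ∣ A ─ T ∣ ≤ ∣ T ∩ N (A ─ T) ∣
      A─T-exchange = exchange-bound T-max (λ u v u∈ v∈ → S-ind u v (A─T⊆S u∈) (A─T⊆S v∈))
                       (λ {v} v∈A─T → x∈p─q⇒x∉q A T v∈A─T)
      T-separates : Disjoint (Y ∩ N (A ∩ T)) (T ∩ N (A ─ T))
      T-separates v∈YN v∈TN =
        let u , u∈A∩T , uv = ∈N⁻ (proj₂ (x∈p∩q⁻ Y _ v∈YN))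
        in T-ind u _ (proj₂ (x∈p∩q⁻ A T u∈A∩T)) (proj₁ (x∈p∩q⁻ T _ v∈TN)) uv
      inner⊆ : Y ∩ N (A ∩ T) ⊆ Y ∩ N A
      inner⊆ v∈ = let v∈Y , v∈N = x∈p∩q⁻ Y _ v∈ in x∈p∩q⁺ (v∈Y , N-mono (p∩q⊆p A T) v∈N)
      outer⊆ : T ∩ N (A ─ T) ⊆ Y ∩ N A
      outer⊆ {t} t∈ = x∈p∩q⁺ (∈-filter⁺ _ t∉S∪N[C] , N-mono (p─q⊆p A T) t∈N)
        where
        t∈T = proj₁ (x∈p∩q⁻ T _ t∈)
        t∈N = proj₂ (x∈p∩q⁻ T _ t∈)
        t∉S∪N[C] : ¬ (t ∈ S ⊎ InClosedNbhd G C t)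
        t∉S∪N[C] (inj₁ t∈S) = let b , b∈A─T , bt = ∈N⁻ t∈N in S-ind b t (A─T⊆S b∈A─T) t∈S bt
        t∉S∪N[C] (inj₂ (inj₁ t∈C)) = t∉S∪N[C] (inj₁ (C⊆maximum S-max t∈C))
        t∉S∪N[C] (inj₂ (inj₂ (c , c∈C , ct))) = T-ind c t (C⊆maximum T-max c∈C) t∈T ct

    no-deficient-set : {A : Subset n} (k : ℕ) → ∣ A ∣ ≤ k → A ⊆ S ─ C → ¬ ∣ Y ∩ N A ∣ < ∣ A ∣
    no-deficient-set zero ∣A∣≤0 _ deficient = contradiction (≤-trans deficient ∣A∣≤0) λ ()
    no-deficient-set {A} (suc k) ∣A∣≤1+k A⊆S─C deficient
      with 0<∣p∣⇒nonempty A (≤-<-trans z≤n deficient)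
    ... | v , v∈A = x∈p─q⇒x∉q S C (A⊆S─C v∈A) (Equivalence.from (C-core v) v∈maximum)
      where
      v∈maximum : ∀ T → MaximumIndependent G T → v ∈ T
      v∈maximum T T-max with v ∈? T
      ... | yes v∈T = v∈T
      ... | no  v∉T = contradiction (deficiency-shrinks T-max (p─q⊆p S C ∘ A⊆S─C) deficient)
                        (no-deficient-set k (≤-pred (<-≤-trans ∣A∩T∣<∣A∣ ∣A∣≤1+k)) (A⊆S─C ∘ p∩q⊆p A T))
        where
        ∣A∩T∣<∣A∣ : ∣ A ∩ T ∣ < ∣ A ∣
        ∣A∩T∣<∣A∣ = p⊂q⇒∣p∣<∣q∣ (p∩q⊆p A T , v , v∈A , v∉T ∘ proj₂ ∘ x∈p∩q⁻ A T)

    S─C-matching : MatchingInto (S ─ C) Y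
    S─C-matching = hall ∣ S ─ C ∣ ≤-refl (λ v∈S─C v∈Y → Y-avoids v∈Y (inj₁ (p─q⊆p S C v∈S─C)))
                     λ A A⊆S─C → ≮⇒≥ (no-deficient-set ∣ A ∣ ≤-refl A⊆S─C)

  α+μ[N[C]]≤μ+∣C∣ : {a m m′ : ℕ} {C : Subset n} → IsIndependenceNumber G a → IsCore G C →
                    IsMatchingNumber G m → IsMatchingNumberIn G (InClosedNbhd G C) m′ → a + m′ ≤ m + ∣ C ∣
  α+μ[N[C]]≤μ+∣C∣ {a} {m} {m′} {C} ((S , S-ind , ∣S∣≡a) , α-max) C-core (_ , μ-max)
                  ((M′ , M′-matching , ∣M′∣≡m′) , _) = begin
      a + m′                                     ≡⟨ cong (_+ m′) ∣S∣≡a ⟨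
      ∣ S ∣ + m′                                 ≡⟨ cong (_+ m′) (q⊆p⇒∣q∣+∣p─q∣≡∣p∣ (C⊆maximum S-max)) ⟨
      ∣ C ∣ + ∣ S ─ C ∣ + m′                     ≡⟨ +-assoc ∣ C ∣ ∣ S ─ C ∣ m′ ⟩
      ∣ C ∣ + (∣ S ─ C ∣ + m′)                   ≡⟨ cong₂ (λ k l → ∣ C ∣ + (k + l)) (saturates L) ∣M′∣≡m′ ⟨
      ∣ C ∣ + (length (edges L) + length M′)     ≡⟨ cong (∣ C ∣ +_) (length-++ (edges L)) ⟨
      ∣ C ∣ + length (edges L ++ M′)             ≤⟨ +-monoʳ-≤ ∣ C ∣ (μ-max (edges L ++ M′) (matching-++ L avoids M′-matching)) ⟩
      ∣ C ∣ + m                                  ≡⟨ +-comm ∣ C ∣ m ⟩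
      m + ∣ C ∣                                  ∎
    where
    open ≤-Reasoning
    S-max : MaximumIndependent G S
    S-max = S-ind , λ T T-ind → subst (∣ T ∣ ≤_) (≡.sym ∣S∣≡a) (α-max T T-ind)
    open CoreMatching S-max C-core
    L = S─C-matching
    avoids : ∀ {v} → v ∈ S ─ C ⊎ v ∈ Y → ¬ InClosedNbhd G C v
    avoids (inj₁ v∈S─C) = S─C-avoids-N[C] v∈S─C
    avoids (inj₂ v∈Y)   = Y-avoids v∈Y ∘ inj₂

¬¬-∀-Fin : {k : ℕ} {P : Fin k → Set} → (∀ i → ¬ ¬ P i) → ¬ ¬ (∀ i → P i)
¬¬-∀-Fin {zero}  _   ¬∀P = ¬∀P λ ()
¬¬-∀-Fin {suc k} ¬¬P ¬∀P = ¬¬P zero λ P0 → ¬¬-∀-Fin (¬¬P ∘ suc) λ P+ → ¬∀P λ where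
  zero    → P0
  (suc i) → P+ i

corollary7 : (n : ℕ) (G : Graph n) (a m m′ : ℕ) (C : Subset n) →
    IsIndependenceNumber G a →
    IsCore G C →
    IsMatchingNumber G m →
    IsMatchingNumberIn G (InClosedNbhd G C) m′ →
    a ≤ m + ∣ C ∣ ∸ m′
corollary7 n G a m m′ C isα isCore isμ isμ′ = decidable-stable (a ≤? m + ∣ C ∣ ∸ m′)
  (¬¬-map (λ adj? → m+n≤o⇒m≤o∸n a (α+μ[N[C]]≤μ+∣C∣ G adj? isα isCore isμ isμ′))
          (¬¬-∀-Fin λ u → ¬¬-∀-Fin λ v → ¬¬-excluded-middle))
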